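{- Let $(a_n)_{n=0}^\infty$ be a sequence of integers such that $a_0>0$, $a_1\ge 1$, $a_0\le a_1$, $a_n=a_{n-1}+a_{n-2}$ for all $n\ge 2$, and $a_0^2+a_1a_0-a_1^2>0$. Then for all $n\ge 0$, $$\frac{1}{a_{2n+1}}-\frac{1}{a_{2n+2}}-\frac{1}{a_{2n+3}}>0.$$ -}

module Defs where

open import Data.Nat using (ℕ; suc)
open import Data.Integer using (ℤ; +_; -[1+_])
open import Data.Rational using (ℚ; 0ℚ; _/_; -_)

-- Reciprocal of an integer as a rational number, 1/a.
-- Convention: 1/0 := 0 (never used under the theorem's hypotheses,
-- where all terms of the sequence are positive).
recipℤ : ℤ → ℚ
recipℤ (+ 0)       = 0ℚ
recipℤ (+ (suc n)) = (+ 1) / suc n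
recipℤ -[1+ n ]    = - ((+ 1) / suc n)

{-# OPTIONS --safe #-}
-- With x, y, z the consecutive terms a (2n+1), a (2n+2), a (2n+3), all positive, the sign of
-- 1/x - 1/y - 1/z is that of yz - xz - xy, which the recurrence turns into the Cassini quantity
-- a (2n) ^ 2 + a (2n+1) a (2n) - a (2n+1) ^ 2.  That quantity changes sign at every step, so at
-- even indices it equals its value at 0, positive by hypothesis.
module Submission where

open import Defs
open import Data.Nat using (ℕ; suc) renaming (_+_ to _+ℕ_; _*_ to _*ℕ_)
open import Data.Integer using (ℤ; +_; _+_; _-_; _*_; _≤_; _<_)
open import Data.Rational using (ℚ; 0ℚ) renaming (_-_ to _-ℚ_; _<_ to _<ℚ_)
open import Relation.Binary.PropositionalEquality using (_≡_)

import Data.Nat.Properties as ℕ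
open import Data.Integer using (-_; +<+; +[1+_]; 0ℤ; 1ℤ)
import Data.Integer.Properties as ℤ
open import Data.Integer.Tactic.RingSolver using (solve-∀)
open import Data.Rational using (toℚᵘ) renaming (-_ to -ℚ_)
import Data.Rational.Properties as ℚ
open import Data.Rational.Unnormalised as ℚᵘ using (mkℚᵘ; 0ℚᵘ; *<*; _≃_)
import Data.Rational.Unnormalised.Properties as ℚᵘ
open import Data.Product using (_×_; _,_; proj₁)
open import Relation.Binary.PropositionalEquality using (refl; sym; trans; cong; subst; module ≡-Reasoning)

toℚᵘ-homo-sub : ∀ p q → toℚᵘ (p -ℚ q) ≃ toℚᵘ p ℚᵘ.- toℚᵘ q
toℚᵘ-homo-sub p q =
  ℚᵘ.≃-trans (ℚ.toℚᵘ-homo-+ p (-ℚ q)) (ℚᵘ.+-congʳ (toℚᵘ p) (ℚ.toℚᵘ-homo‿- q))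

sub-cong : ∀ {p p′ q q′} → p ≃ p′ → q ≃ q′ → p ℚᵘ.- q ≃ p′ ℚᵘ.- q′
sub-cong p≃p′ q≃q′ = ℚᵘ.+-cong p≃p′ (ℚᵘ.-‿cong q≃q′)

toℚᵘ-recipℤ : ∀ n → toℚᵘ (recipℤ +[1+ n ]) ≃ mkℚᵘ 1ℤ n
toℚᵘ-recipℤ n = ℚ.toℚᵘ-fromℚᵘ (mkℚᵘ 1ℤ n)

-- The right-hand side is the numerator that ℚᵘ computes for 1/X - 1/Y - 1/Z, times the
-- denominator 1 of 0.
recip-sub-sub-numerator : ∀ X Y Z →
  Y * Z - X * Z - X * Y ≡ ((1ℤ * Y + - 1ℤ * X) * Z + - 1ℤ * (X * Y)) * 1ℤ
recip-sub-sub-numerator = solve-∀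

recip-sub-sub-positiveᵘ : ∀ x y z →
  0ℤ < +[1+ y ] * +[1+ z ] - +[1+ x ] * +[1+ z ] - +[1+ x ] * +[1+ y ] →
  0ℚᵘ ℚᵘ.< (mkℚᵘ 1ℤ x ℚᵘ.- mkℚᵘ 1ℤ y) ℚᵘ.- mkℚᵘ 1ℤ z
recip-sub-sub-positiveᵘ x y z numerator>0 =
  *<* (subst (0ℤ <_) (recip-sub-sub-numerator +[1+ x ] +[1+ y ] +[1+ z ]) numerator>0)

recipℤ-sub-sub-positive : ∀ {x y z} → 0ℤ < x → 0ℤ < y → 0ℤ < z →
  0ℤ < y * z - x * z - x * y → 0ℚ <ℚ (recipℤ x -ℚ recipℤ y) -ℚ recipℤ z
recipℤ-sub-sub-positive (+<+ {n = suc x} _) (+<+ {n = suc y} _) (+<+ {n = suc z} _) numerator>0 =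
  ℚ.toℚᵘ-cancel-< (ℚᵘ.<-respʳ-≃ (ℚᵘ.≃-sym toℚᵘ-difference) (recip-sub-sub-positiveᵘ x y z numerator>0))
  where
  open ℚᵘ.≃-Reasoning
  r : ℕ → ℚ
  r n = recipℤ +[1+ n ]
  toℚᵘ-difference : toℚᵘ ((r x -ℚ r y) -ℚ r z) ≃ (mkℚᵘ 1ℤ x ℚᵘ.- mkℚᵘ 1ℤ y) ℚᵘ.- mkℚᵘ 1ℤ z
  toℚᵘ-difference = begin
    toℚᵘ ((r x -ℚ r y) -ℚ r z)                   ≈⟨ toℚᵘ-homo-sub (r x -ℚ r y) (r z) ⟩
    toℚᵘ (r x -ℚ r y) ℚᵘ.- toℚᵘ (r z)            ≈⟨ sub-cong (toℚᵘ-homo-sub (r x) (r y)) ℚᵘ.≃-refl ⟩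
    (toℚᵘ (r x) ℚᵘ.- toℚᵘ (r y)) ℚᵘ.- toℚᵘ (r z) ≈⟨ sub-cong (sub-cong (toℚᵘ-recipℤ x) (toℚᵘ-recipℤ y)) (toℚᵘ-recipℤ z) ⟩
    (mkℚᵘ 1ℤ x ℚᵘ.- mkℚᵘ 1ℤ y) ℚᵘ.- mkℚᵘ 1ℤ z   ∎

cassini-step : ∀ w x → x * x + (x + w) * x - (x + w) * (x + w) ≡ - (w * w + x * w - x * x)
cassini-step = solve-∀

reciprocal-numerator-step : ∀ w x →
  (x + w) * ((x + w) + x) - x * ((x + w) + x) - x * (x + w) ≡ w * w + x * w - x * x
reciprocal-numerator-step = solve-∀

module FibonacciRecurrence (a : ℕ → ℤ) (a-rec : ∀ n → a (suc (suc n)) ≡ a (suc n) + a n) where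

  open ≡-Reasoning

  -- Equal to a k * a (k+2) - a (k+1) ^ 2 by the recurrence, hence the name.
  cassini : ℕ → ℤ
  cassini k = a k * a k + a (suc k) * a k - a (suc k) * a (suc k)

  cassini-suc : ∀ k → cassini (suc k) ≡ - cassini k
  cassini-suc k = begin
    cassini (suc k)                         ≡⟨ cong (λ t → x * x + t * x - t * t) (a-rec k) ⟩
    x * x + (x + w) * x - (x + w) * (x + w) ≡⟨ cassini-step w x ⟩
    - cassini k                             ∎
    where
    w x : ℤ
    w = a k
    x = a (suc k)

  cassini-suc-suc : ∀ k → cassini (suc (suc k)) ≡ cassini k
  cassini-suc-suc k = begin
    cassini (suc (suc k)) ≡⟨ cassini-suc (suc k) ⟩
    - cassini (suc k)     ≡⟨ cong -_ (cassini-suc k) ⟩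
    - - cassini k         ≡⟨ ℤ.neg-involutive (cassini k) ⟩
    cassini k             ∎

  cassini-even : ∀ n → cassini (2 *ℕ n) ≡ cassini 0
  cassini-even 0       = refl
  cassini-even (suc n) = begin
    cassini (2 *ℕ suc n)  ≡⟨ cong cassini (ℕ.*-suc 2 n) ⟩
    cassini (2 +ℕ 2 *ℕ n) ≡⟨ cassini-suc-suc (2 *ℕ n) ⟩
    cassini (2 *ℕ n)      ≡⟨ cassini-even n ⟩
    cassini 0             ∎

  reciprocal-numerator≡cassini : ∀ k →
    let x = a (suc k); y = a (suc (suc k)); z = a (suc (suc (suc k)))
    in y * z - x * z - x * y ≡ cassini k
  reciprocal-numerator≡cassini k = begin
    y * z - x * z - x * y                                     ≡⟨ cong (λ t → y * t - x * t - x * y) (a-rec (suc k)) ⟩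
    y * (y + x) - x * (y + x) - x * y                         ≡⟨ cong (λ t → t * (t + x) - x * (t + x) - x * t) (a-rec k) ⟩
    (x + w) * ((x + w) + x) - x * ((x + w) + x) - x * (x + w) ≡⟨ reciprocal-numerator-step w x ⟩
    cassini k                                                 ∎
    where
    w x y z : ℤ
    w = a k
    x = a (suc k)
    y = a (suc (suc k))
    z = a (suc (suc (suc k)))

  positive : 0ℤ < a 0 → 0ℤ < a 1 → ∀ k → 0ℤ < a k
  positive a₀>0 a₁>0 k = proj₁ (consecutive-positive k)
    where
    consecutive-positive : ∀ k → 0ℤ < a k × 0ℤ < a (suc k)
    consecutive-positive 0       = a₀>0 , a₁>0
    consecutive-positive (suc k) with consecutive-positive k
    ... | aₖ>0 , aₖ₊₁>0 = aₖ₊₁>0 , subst (0ℤ <_) (sym (a-rec k)) (ℤ.+-mono-< aₖ₊₁>0 aₖ>0)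

corollary2p4 : (a : ℕ → ℤ) → + 0 < a 0 → + 1 ≤ a 1 → a 0 ≤ a 1
    → (∀ n → a (suc (suc n)) ≡ a (suc n) + a n)
    → + 0 < a 0 * a 0 + a 1 * a 0 - a 1 * a 1
    → ∀ (n : ℕ) → 0ℚ <ℚ (recipℤ (a (suc (2 *ℕ n))) -ℚ recipℤ (a (2 +ℕ 2 *ℕ n))) -ℚ recipℤ (a (3 +ℕ 2 *ℕ n))
corollary2p4 a a₀>0 a₁≥1 _ a-rec cassini₀>0 n =
  recipℤ-sub-sub-positive (a>0 (suc m)) (a>0 (2 +ℕ m)) (a>0 (3 +ℕ m)) numerator>0
  where
  open FibonacciRecurrence a a-rec
  m : ℕ
  m = 2 *ℕ n
  a>0 : ∀ k → 0ℤ < a k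
  a>0 = positive a₀>0 (ℤ.suc[i]≤j⇒i<j a₁≥1)
  numerator>0 : 0ℤ < a (2 +ℕ m) * a (3 +ℕ m) - a (suc m) * a (3 +ℕ m) - a (suc m) * a (2 +ℕ m)
  numerator>0 = subst (0ℤ <_) (sym (trans (reciprocal-numerator≡cassini m) (cassini-even n))) cassini₀>0
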